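{- For every derivation in $\mathsf{SNEL}$ from $T$ to $R$ there is a derivation of the shape $T\xrightarrow{\{\mathsf{e}\downarrow\}}W_1\xrightarrow{\mathsf{SNEL}\setminus\{\mathsf{e}\downarrow,\mathsf{e}\uparrow\}}Z_1\xrightarrow{\{\mathsf{e}\uparrow\}}R$ for some structures $W_1,Z_1$.
   Context: Atoms: countably many atoms $a,b,\dots$, each atom $a$ having a dual atom $\bar a$ with $\bar{\bar a}=a$. Structures are generated by $S::= a\mid \circ \mid [S,\dots,S]\mid (S,\dots,S)\mid \langle S;\dots;S\rangle \mid ?S\mid !S\mid \bar S$ (par, tensor, seq with at least one argument; unit $\circ$ not an atom), identified modulo the least congruence $=$ making par, tensor, seq associative, par and tensor commutative, $\circ$ a unit for all three, $[R]=(R)=\langle R\rangle=R$, with $\bar\circ=\circ$, $\overline{[R_1,\dots,R_h]}=(\bar R_1,\dots,\bar R_h)$, $\overline{(R_1,\dots,R_h)}=[\bar R_1,\dots,\bar R_h]$, $\overline{\langle R_1;\dots;R_h\rangle}=\langle\bar R_1;\dots;\bar R_h\rangle$, $\overline{?R}=!\bar R$, $\overline{!R}=?\bar R$, $\bar{\bar R}=R$. A context $S\{\;\}$ is a structure with one hole not under negation; $S[R,T]$ abbreviates $S\{[R,T]\}$ etc. A derivation in a rule set is a finite vertical chain of rule instances (each conclusion equal modulo $=$ to the next premise), possibly a single structure; top = premise, bottom = conclusion. System $\mathsf{SNEL}$ (premise $\Rightarrow$ conclusion): $\mathsf{ai}\downarrow$: $S\{\circ\}\Rightarrow S[a,\bar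 a]$; $\mathsf{ai}\uparrow$: $S(a,\bar a)\Rightarrow S\{\circ\}$; $\mathsf{s}$: $S([R,U],T)\Rightarrow S[(R,T),U]$; $\mathsf{q}\downarrow$: $S\langle[R,U];[T,V]\rangle\Rightarrow S[\langle R;T\rangle,\langle U;V\rangle]$; $\mathsf{q}\uparrow$: $S(\langle R;U\rangle,\langle T;V\rangle)\Rightarrow S\langle(R,T);(U,V)\rangle$; $\mathsf{p}\downarrow$: $S\{![R,T]\}\Rightarrow S[!R,?T]$; $\mathsf{p}\uparrow$: $S(?R,!T)\Rightarrow S\{?(R,T)\}$; $\mathsf{e}\downarrow$: $S\{\circ\}\Rightarrow S\{!\circ\}$; $\mathsf{e}\uparrow$: $S\{?\circ\}\Rightarrow S\{\circ\}$; $\mathsf{w}\downarrow$: $S\{\circ\}\Rightarrow S\{?R\}$; $\mathsf{w}\uparrow$: $S\{!R\}\Rightarrow S\{\circ\}$; $\mathsf{b}\downarrow$: $S[?R,R]\Rightarrow S\{?R\}$; $\mathsf{b}\uparrow$: $S\{!R\}\Rightarrow S(!R,R)$; $\mathsf{g}\downarrow$: $S\{??R\}\Rightarrow S\{?R\}$; $\mathsf{g}\uparrow$: $S\{!R\}\Rightarrow S\{!!R\}$. Notation $X_0\xrightarrow{\mathcal X_1}X_1\xrightarrow{\mathcal X_2}\cdots\xrightarrow{\mathcal X_k}X_k$ denotes a derivation from $X_0$ to $X_k$ obtained by stacking, for each $i$, a derivation from $X_{i-1}$ to $X_i$ using only rules of $\mathcal X_i$ (possibly with no rule instance). -}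

module Defs where

open import Data.Nat using (ℕ)
open import Data.Bool using (Bool; not)
open import Data.Unit using (⊤)
open import Data.Empty using (⊥)
open import Data.Product using (Σ; _×_)

-- Atom (a , true) is a, (a , false) is its dual ā.
-- n-ary par/tensor/seq are represented by binary constructors; together
-- with associativity and the unit laws this gives the same quotient
-- (e.g. [R] = R is just R).
data Str : Set where
  atom : ℕ → Bool → Str
  unit : Str
  par  : Str → Str → Str
  ten  : Str → Str → Str
  seq  : Str → Str → Str
  wn   : Str → Str
  oc   : Str → Str
  neg  : Str → Str

infix 4 _≈_
data _≈_ : Str → Str → Set where
  ≈refl  : ∀ {R} → R ≈ R
  ≈sym   : ∀ {R T} → R ≈ T → T ≈ R
  ≈trans : ∀ {R T U} → R ≈ T → T ≈ U → R ≈ U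
  par-cong : ∀ {R R′ T T′} → R ≈ R′ → T ≈ T′ → par R T ≈ par R′ T′
  ten-cong : ∀ {R R′ T T′} → R ≈ R′ → T ≈ T′ → ten R T ≈ ten R′ T′
  seq-cong : ∀ {R R′ T T′} → R ≈ R′ → T ≈ T′ → seq R T ≈ seq R′ T′
  wn-cong  : ∀ {R R′} → R ≈ R′ → wn R ≈ wn R′
  oc-cong  : ∀ {R R′} → R ≈ R′ → oc R ≈ oc R′
  neg-cong : ∀ {R R′} → R ≈ R′ → neg R ≈ neg R′
  par-assoc : ∀ {R T U} → par (par R T) U ≈ par R (par T U)
  ten-assoc : ∀ {R T U} → ten (ten R T) U ≈ ten R (ten T U)
  seq-assoc : ∀ {R T U} → seq (seq R T) U ≈ seq R (seq T U)
  par-comm : ∀ {R T} → par R T ≈ par T R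
  ten-comm : ∀ {R T} → ten R T ≈ ten T R
  par-unit : ∀ {R} → par unit R ≈ R
  ten-unit : ∀ {R} → ten unit R ≈ R
  seq-unitˡ : ∀ {R} → seq unit R ≈ R
  seq-unitʳ : ∀ {R} → seq R unit ≈ R
  neg-atom : ∀ {a b} → neg (atom a b) ≈ atom a (not b)
  neg-unit : neg unit ≈ unit
  neg-par  : ∀ {R T} → neg (par R T) ≈ ten (neg R) (neg T)
  neg-ten  : ∀ {R T} → neg (ten R T) ≈ par (neg R) (neg T)
  neg-seq  : ∀ {R T} → neg (seq R T) ≈ seq (neg R) (neg T)
  neg-wn   : ∀ {R} → neg (wn R) ≈ oc (neg R)
  neg-oc   : ∀ {R} → neg (oc R) ≈ wn (neg R)
  neg-neg  : ∀ {R} → neg (neg R) ≈ R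

data Ctx : Set where
  hole : Ctx
  parL : Ctx → Str → Ctx
  parR : Str → Ctx → Ctx
  tenL : Ctx → Str → Ctx
  tenR : Str → Ctx → Ctx
  seqL : Ctx → Str → Ctx
  seqR : Str → Ctx → Ctx
  wnC  : Ctx → Ctx
  ocC  : Ctx → Ctx

_[_] : Ctx → Str → Str
hole     [ R ] = R
parL C S [ R ] = par (C [ R ]) S
parR S C [ R ] = par S (C [ R ])
tenL C S [ R ] = ten (C [ R ]) S
tenR S C [ R ] = ten S (C [ R ])
seqL C S [ R ] = seq (C [ R ]) S
seqR S C [ R ] = seq S (C [ R ])
wnC C    [ R ] = wn (C [ R ])
ocC C    [ R ] = oc (C [ R ])

data Rule : Set where
  ai↓ ai↑ s q↓ q↑ p↓ p↑ e↓ e↑ w↓ w↑ b↓ b↑ g↓ g↑ : Rule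

-- Redex instances: Inst ρ P C means  P / C  (premise P, conclusion C)
-- is an instance of rule ρ in the empty context.
data Inst : Rule → Str → Str → Set where
  i-ai↓ : ∀ a b → Inst ai↓ unit (par (atom a b) (atom a (not b)))
  i-ai↑ : ∀ a b → Inst ai↑ (ten (atom a b) (atom a (not b))) unit
  i-s   : ∀ R T U → Inst s (ten (par R U) T) (par (ten R T) U)
  i-q↓  : ∀ R T U V → Inst q↓ (seq (par R U) (par T V)) (par (seq R T) (seq U V))
  i-q↑  : ∀ R T U V → Inst q↑ (ten (seq R U) (seq T V)) (seq (ten R T) (ten U V))
  i-p↓  : ∀ R T → Inst p↓ (oc (par R T)) (par (oc R) (wn T))
  i-p↑  : ∀ R T → Inst p↑ (ten (wn R) (oc T)) (wn (ten R T))
  i-e↓  : Inst e↓ unit (oc unit)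
  i-e↑  : Inst e↑ (wn unit) unit
  i-w↓  : ∀ R → Inst w↓ unit (wn R)
  i-w↑  : ∀ R → Inst w↑ (oc R) unit
  i-b↓  : ∀ R → Inst b↓ (par (wn R) R) (wn R)
  i-b↑  : ∀ R → Inst b↑ (oc R) (ten (oc R) R)
  i-g↓  : ∀ R → Inst g↓ (wn (wn R)) (wn R)
  i-g↑  : ∀ R → Inst g↑ (oc R) (oc (oc R))

RuleSet : Set₁
RuleSet = Rule → Set

record Step (X : RuleSet) (P Q : Str) : Set where
  constructor step
  field
    rule    : Rule
    inX     : X rule
    ctx     : Ctx
    redex   : Str
    contr   : Str
    inst    : Inst rule redex contr
    premEq  : P ≈ ctx [ redex ]
    conclEq : Q ≈ ctx [ contr ]

-- Derivations (top = premise T, bottom = conclusion R); a single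
-- structure (no rule instance) is a derivation from T to any R = T.
data Deriv (X : RuleSet) : Str → Str → Set where
  done : ∀ {T R} → T ≈ R → Deriv X T R
  _∷_  : ∀ {T U R} → Step X T U → Deriv X U R → Deriv X T R

SNEL : RuleSet
SNEL _ = ⊤

only-e↓ : RuleSet
only-e↓ e↓ = ⊤
only-e↓ _  = ⊥

only-e↑ : RuleSet
only-e↑ e↑ = ⊤
only-e↑ _  = ⊥

SNEL-no-e : RuleSet
SNEL-no-e e↓ = ⊥
SNEL-no-e e↑ = ⊥
SNEL-no-e _  = ⊤

-- Translate a structure S into ⟦ S ⟧ by replacing every ?R with ?[R, ?∘] and every !R
-- with !(R, !∘), and work with  image S = [(⟦ S ⟧, !∘), ?∘],  which carries one spare
-- !∘ and one spare ?∘.  Every rule instance other than e↓, e↑ is simulated on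
-- translations by e-free rules.  An instance ∘ → !∘ of e↓ is simulated by copying the
-- !∘ stored at the nearest enclosing ! (or the spare one, at top level) and pushing it
-- down to the hole; dually ?∘ → ∘ of e↑ is pushed up to the nearest enclosing ? (or the
-- spare one) and absorbed there.  So a derivation T → R becomes an e-free derivation
-- image T → image R.  Since T ≈ enrich ∘ ∘ T, the !∘ markers are created from ∘ by e↓
-- at the top and the ?∘ markers destroyed by e↑ at the bottom; the ?∘ markers are
-- introduced by w↓ and the !∘ markers removed by w↑ inside the e-free part.
module Submission where

open import Data.Bool using (Bool; true; false; not)
open import Data.Product using (Σ; _×_; _,_)
open import Data.Unit using (tt)
open import Relation.Binary.PropositionalEquality using (_≡_; refl; sym; cong)

open import Defs

≡⇒≈ : ∀ {R T} → R ≡ T → R ≈ T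
≡⇒≈ refl = ≈refl

par-unitʳ : ∀ {R} → par R unit ≈ R
par-unitʳ = ≈trans par-comm par-unit

ten-unitʳ : ∀ {R} → ten R unit ≈ R
ten-unitʳ = ≈trans ten-comm ten-unit

plug-cong : ∀ C {R T} → R ≈ T → C [ R ] ≈ C [ T ]
plug-cong hole       e = e
plug-cong (parL C S) e = par-cong (plug-cong C e) ≈refl
plug-cong (parR S C) e = par-cong ≈refl (plug-cong C e)
plug-cong (tenL C S) e = ten-cong (plug-cong C e) ≈refl
plug-cong (tenR S C) e = ten-cong ≈refl (plug-cong C e)
plug-cong (seqL C S) e = seq-cong (plug-cong C e) ≈refl
plug-cong (seqR S C) e = seq-cong ≈refl (plug-cong C e)
plug-cong (wnC C)    e = wn-cong (plug-cong C e)
plug-cong (ocC C)    e = oc-cong (plug-cong C e)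

infixr 6 _⊙_
_⊙_ : Ctx → Ctx → Ctx
hole     ⊙ D = D
parL C S ⊙ D = parL (C ⊙ D) S
parR S C ⊙ D = parR S (C ⊙ D)
tenL C S ⊙ D = tenL (C ⊙ D) S
tenR S C ⊙ D = tenR S (C ⊙ D)
seqL C S ⊙ D = seqL (C ⊙ D) S
seqR S C ⊙ D = seqR S (C ⊙ D)
wnC C    ⊙ D = wnC (C ⊙ D)
ocC C    ⊙ D = ocC (C ⊙ D)

plug-⊙ : ∀ C D R → (C ⊙ D) [ R ] ≡ C [ D [ R ] ]
plug-⊙ hole       D R = refl
plug-⊙ (parL C S) D R = cong (λ z → par z S) (plug-⊙ C D R)
plug-⊙ (parR S C) D R = cong (par S) (plug-⊙ C D R)
plug-⊙ (tenL C S) D R = cong (λ z → ten z S) (plug-⊙ C D R)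
plug-⊙ (tenR S C) D R = cong (ten S) (plug-⊙ C D R)
plug-⊙ (seqL C S) D R = cong (λ z → seq z S) (plug-⊙ C D R)
plug-⊙ (seqR S C) D R = cong (seq S) (plug-⊙ C D R)
plug-⊙ (wnC C)    D R = cong wn (plug-⊙ C D R)
plug-⊙ (ocC C)    D R = cong oc (plug-⊙ C D R)

module _ {X : RuleSet} where

  deriv-≈ˡ : ∀ {A A′ B} → A ≈ A′ → Deriv X A′ B → Deriv X A B
  deriv-≈ˡ e (done e′) = done (≈trans e e′)
  deriv-≈ˡ e (step ρ x C r c i pe ce ∷ d) = step ρ x C r c i (≈trans e pe) ce ∷ d

  infixr 5 _++_
  _++_ : ∀ {A B C} → Deriv X A B → Deriv X B C → Deriv X A C
  done e   ++ d′ = deriv-≈ˡ e d′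
  (st ∷ d) ++ d′ = st ∷ (d ++ d′)

  deriv-≈ʳ : ∀ {A B B′} → Deriv X A B′ → B′ ≈ B → Deriv X A B
  deriv-≈ʳ d e = d ++ done e

  deriv-in-ctx : ∀ (C : Ctx) {A B} → Deriv X A B → Deriv X (C [ A ]) (C [ B ])
  deriv-in-ctx C (done e) = done (plug-cong C e)
  deriv-in-ctx C (step ρ x D r c i pe ce ∷ d) =
    step ρ x (C ⊙ D) r c i (in-C pe) (in-C ce) ∷ deriv-in-ctx C d
    where
    in-C : ∀ {A R} → A ≈ D [ R ] → C [ A ] ≈ (C ⊙ D) [ R ]
    in-C {R = R} e = ≈trans (plug-cong C e) (≡⇒≈ (sym (plug-⊙ C D R)))

  apply≈ : ∀ {ρ A B R T} → X ρ → (C : Ctx) → Inst ρ R T →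
           A ≈ C [ R ] → C [ T ] ≈ B → Deriv X A B
  apply≈ {ρ} {R = R} {T} x C i pe ce = step ρ x C R T i pe ≈refl ∷ done ce

  apply : ∀ {ρ R T} → X ρ → (C : Ctx) → Inst ρ R T → Deriv X (C [ R ]) (C [ T ])
  apply x C i = apply≈ x C i ≈refl ≈refl

  par-deriv : ∀ {R R′ T T′} → Deriv X R R′ → Deriv X T T′ → Deriv X (par R T) (par R′ T′)
  par-deriv {R′ = R′} {T = T} dR dT = deriv-in-ctx (parL hole T) dR ++ deriv-in-ctx (parR R′ hole) dT

  ten-deriv : ∀ {R R′ T T′} → Deriv X R R′ → Deriv X T T′ → Deriv X (ten R T) (ten R′ T′)
  ten-deriv {R′ = R′} {T = T} dR dT = deriv-in-ctx (tenL hole T) dR ++ deriv-in-ctx (tenR R′ hole) dT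

  seq-deriv : ∀ {R R′ T T′} → Deriv X R R′ → Deriv X T T′ → Deriv X (seq R T) (seq R′ T′)
  seq-deriv {R′ = R′} {T = T} dR dT = deriv-in-ctx (seqL hole T) dR ++ deriv-in-ctx (seqR R′ hole) dT

  wn-deriv : ∀ {R R′} → Deriv X R R′ → Deriv X (wn R) (wn R′)
  wn-deriv = deriv-in-ctx (wnC hole)

  oc-deriv : ∀ {R R′} → Deriv X R R′ → Deriv X (oc R) (oc R′)
  oc-deriv = deriv-in-ctx (ocC hole)

-- Polarity false translates the negation of the argument, which pushes negations to atoms.
enrich : (B Q : Str) → Bool → Str → Str
enrich B Q p     unit       = unit
enrich B Q p     (seq R T)  = seq (enrich B Q p R) (enrich B Q p T)
enrich B Q p     (neg R)    = enrich B Q (not p) R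
enrich B Q true  (atom a b) = atom a b
enrich B Q false (atom a b) = atom a (not b)
enrich B Q true  (par R T)  = par (enrich B Q true R) (enrich B Q true T)
enrich B Q false (par R T)  = ten (enrich B Q false R) (enrich B Q false T)
enrich B Q true  (ten R T)  = ten (enrich B Q true R) (enrich B Q true T)
enrich B Q false (ten R T)  = par (enrich B Q false R) (enrich B Q false T)
enrich B Q true  (wn R)     = wn (par (enrich B Q true R) Q)
enrich B Q false (wn R)     = oc (ten (enrich B Q false R) B)
enrich B Q true  (oc R)     = oc (ten (enrich B Q true R) B)
enrich B Q false (oc R)     = wn (par (enrich B Q false R) Q)

enrich-cong : ∀ B Q p {R T} → R ≈ T → enrich B Q p R ≈ enrich B Q p T
enrich-cong B Q p     ≈refl           = ≈refl
enrich-cong B Q p     (≈sym e)        = ≈sym (enrich-cong B Q p e)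
enrich-cong B Q p     (≈trans e f)    = ≈trans (enrich-cong B Q p e) (enrich-cong B Q p f)
enrich-cong B Q true  (par-cong e f)  = par-cong (enrich-cong B Q true e) (enrich-cong B Q true f)
enrich-cong B Q false (par-cong e f)  = ten-cong (enrich-cong B Q false e) (enrich-cong B Q false f)
enrich-cong B Q true  (ten-cong e f)  = ten-cong (enrich-cong B Q true e) (enrich-cong B Q true f)
enrich-cong B Q false (ten-cong e f)  = par-cong (enrich-cong B Q false e) (enrich-cong B Q false f)
enrich-cong B Q p     (seq-cong e f)  = seq-cong (enrich-cong B Q p e) (enrich-cong B Q p f)
enrich-cong B Q true  (wn-cong e)     = wn-cong (par-cong (enrich-cong B Q true e) ≈refl)
enrich-cong B Q false (wn-cong e)     = oc-cong (ten-cong (enrich-cong B Q false e) ≈refl)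
enrich-cong B Q true  (oc-cong e)     = oc-cong (ten-cong (enrich-cong B Q true e) ≈refl)
enrich-cong B Q false (oc-cong e)     = wn-cong (par-cong (enrich-cong B Q false e) ≈refl)
enrich-cong B Q p     (neg-cong e)    = enrich-cong B Q (not p) e
enrich-cong B Q true  par-assoc       = par-assoc
enrich-cong B Q false par-assoc       = ten-assoc
enrich-cong B Q true  ten-assoc       = ten-assoc
enrich-cong B Q false ten-assoc       = par-assoc
enrich-cong B Q p     seq-assoc       = seq-assoc
enrich-cong B Q true  par-comm        = par-comm
enrich-cong B Q false par-comm        = ten-comm
enrich-cong B Q true  ten-comm        = ten-comm
enrich-cong B Q false ten-comm        = par-comm
enrich-cong B Q true  par-unit        = par-unit
enrich-cong B Q false par-unit        = ten-unit
enrich-cong B Q true  ten-unit        = ten-unit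
enrich-cong B Q false ten-unit        = par-unit
enrich-cong B Q p     seq-unitˡ       = seq-unitˡ
enrich-cong B Q p     seq-unitʳ       = seq-unitʳ
enrich-cong B Q p     neg-unit        = ≈refl
enrich-cong B Q p     neg-seq         = ≈refl
enrich-cong B Q true  neg-atom        = ≈refl
enrich-cong B Q false (neg-atom {b = true})  = ≈refl
enrich-cong B Q false (neg-atom {b = false}) = ≈refl
enrich-cong B Q true  neg-par         = ≈refl
enrich-cong B Q false neg-par         = ≈refl
enrich-cong B Q true  neg-ten         = ≈refl
enrich-cong B Q false neg-ten         = ≈refl
enrich-cong B Q true  neg-wn          = ≈refl
enrich-cong B Q false neg-wn          = ≈refl
enrich-cong B Q true  neg-oc          = ≈refl
enrich-cong B Q false neg-oc          = ≈refl
enrich-cong B Q true  neg-neg         = ≈refl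
enrich-cong B Q false neg-neg         = ≈refl

≈-enrich-unit : ∀ S → S ≈ enrich unit unit true S
neg-≈-enrich-unit : ∀ S → neg S ≈ enrich unit unit false S
≈-enrich-unit (atom a b) = ≈refl
≈-enrich-unit unit       = ≈refl
≈-enrich-unit (par R T)  = par-cong (≈-enrich-unit R) (≈-enrich-unit T)
≈-enrich-unit (ten R T)  = ten-cong (≈-enrich-unit R) (≈-enrich-unit T)
≈-enrich-unit (seq R T)  = seq-cong (≈-enrich-unit R) (≈-enrich-unit T)
≈-enrich-unit (wn R)     = wn-cong (≈trans (≈-enrich-unit R) (≈sym par-unitʳ))
≈-enrich-unit (oc R)     = oc-cong (≈trans (≈-enrich-unit R) (≈sym ten-unitʳ))
≈-enrich-unit (neg S)    = neg-≈-enrich-unit S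
neg-≈-enrich-unit (atom a b) = neg-atom
neg-≈-enrich-unit unit       = neg-unit
neg-≈-enrich-unit (par R T)  = ≈trans neg-par (ten-cong (neg-≈-enrich-unit R) (neg-≈-enrich-unit T))
neg-≈-enrich-unit (ten R T)  = ≈trans neg-ten (par-cong (neg-≈-enrich-unit R) (neg-≈-enrich-unit T))
neg-≈-enrich-unit (seq R T)  = ≈trans neg-seq (seq-cong (neg-≈-enrich-unit R) (neg-≈-enrich-unit T))
neg-≈-enrich-unit (wn R)     = ≈trans neg-wn (oc-cong (≈trans (neg-≈-enrich-unit R) (≈sym ten-unitʳ)))
neg-≈-enrich-unit (oc R)     = ≈trans neg-oc (wn-cong (≈trans (neg-≈-enrich-unit R) (≈sym par-unitʳ)))
neg-≈-enrich-unit (neg S)    = ≈trans neg-neg (≈-enrich-unit S)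

enrich-mono : ∀ {X B B′ Q Q′} → Deriv X B B′ → Deriv X Q Q′ →
              ∀ p S → Deriv X (enrich B Q p S) (enrich B′ Q′ p S)
enrich-mono dB dQ p     unit       = done ≈refl
enrich-mono dB dQ p     (seq R T)  = seq-deriv (enrich-mono dB dQ p R) (enrich-mono dB dQ p T)
enrich-mono dB dQ p     (neg S)    = enrich-mono dB dQ (not p) S
enrich-mono dB dQ true  (atom a b) = done ≈refl
enrich-mono dB dQ false (atom a b) = done ≈refl
enrich-mono dB dQ true  (par R T)  = par-deriv (enrich-mono dB dQ true R) (enrich-mono dB dQ true T)
enrich-mono dB dQ false (par R T)  = ten-deriv (enrich-mono dB dQ false R) (enrich-mono dB dQ false T)
enrich-mono dB dQ true  (ten R T)  = ten-deriv (enrich-mono dB dQ true R) (enrich-mono dB dQ true T)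
enrich-mono dB dQ false (ten R T)  = par-deriv (enrich-mono dB dQ false R) (enrich-mono dB dQ false T)
enrich-mono dB dQ true  (wn R)     = wn-deriv (par-deriv (enrich-mono dB dQ true R) dQ)
enrich-mono dB dQ false (wn R)     = oc-deriv (ten-deriv (enrich-mono dB dQ false R) dB)
enrich-mono dB dQ true  (oc R)     = oc-deriv (ten-deriv (enrich-mono dB dQ true R) dB)
enrich-mono dB dQ false (oc R)     = wn-deriv (par-deriv (enrich-mono dB dQ false R) dQ)

oc∘ wn∘ : Str
oc∘ = oc unit
wn∘ = wn unit

⟦_⟧ : Str → Str
⟦ S ⟧ = enrich oc∘ wn∘ true S

⟦_⟧ᶜ : Ctx → Ctx
⟦ hole ⟧ᶜ     = hole
⟦ parL C S ⟧ᶜ = parL ⟦ C ⟧ᶜ ⟦ S ⟧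
⟦ parR S C ⟧ᶜ = parR ⟦ S ⟧ ⟦ C ⟧ᶜ
⟦ tenL C S ⟧ᶜ = tenL ⟦ C ⟧ᶜ ⟦ S ⟧
⟦ tenR S C ⟧ᶜ = tenR ⟦ S ⟧ ⟦ C ⟧ᶜ
⟦ seqL C S ⟧ᶜ = seqL ⟦ C ⟧ᶜ ⟦ S ⟧
⟦ seqR S C ⟧ᶜ = seqR ⟦ S ⟧ ⟦ C ⟧ᶜ
⟦ wnC C ⟧ᶜ    = wnC (parL ⟦ C ⟧ᶜ wn∘)
⟦ ocC C ⟧ᶜ    = ocC (tenL ⟦ C ⟧ᶜ oc∘)

⟦⟧-plug : ∀ C R → ⟦ C [ R ] ⟧ ≡ ⟦ C ⟧ᶜ [ ⟦ R ⟧ ]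
⟦⟧-plug hole       R = refl
⟦⟧-plug (parL C S) R = cong (λ z → par z ⟦ S ⟧) (⟦⟧-plug C R)
⟦⟧-plug (parR S C) R = cong (par ⟦ S ⟧) (⟦⟧-plug C R)
⟦⟧-plug (tenL C S) R = cong (λ z → ten z ⟦ S ⟧) (⟦⟧-plug C R)
⟦⟧-plug (tenR S C) R = cong (ten ⟦ S ⟧) (⟦⟧-plug C R)
⟦⟧-plug (seqL C S) R = cong (λ z → seq z ⟦ S ⟧) (⟦⟧-plug C R)
⟦⟧-plug (seqR S C) R = cong (seq ⟦ S ⟧) (⟦⟧-plug C R)
⟦⟧-plug (wnC C)    R = cong (λ z → wn (par z wn∘)) (⟦⟧-plug C R)
⟦⟧-plug (ocC C)    R = cong (λ z → oc (ten z oc∘)) (⟦⟧-plug C R)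

oc-emits-oc∘ : ∀ S → Deriv SNEL-no-e (oc S) (ten (oc S) oc∘)
oc-emits-oc∘ S =
     apply tt hole (i-g↑ S)
  ++ apply tt hole (i-b↑ (oc S))
  ++ apply≈ tt (tenL (ocC hole) (oc S)) (i-w↑ S) ≈refl ten-comm

wn-absorbs-wn∘ : ∀ S → Deriv SNEL-no-e (par (wn S) wn∘) (wn S)
wn-absorbs-wn∘ S =
     apply tt (parR (wn S) (wnC hole)) (i-w↓ S)
  ++ apply≈ tt hole (i-b↓ (wn S)) par-comm ≈refl
  ++ apply tt hole (i-g↓ S)

oc∘-into-hole : ∀ C → Deriv SNEL-no-e (ten (⟦ C ⟧ᶜ [ unit ]) oc∘) (⟦ C ⟧ᶜ [ ⟦ oc∘ ⟧ ])
oc∘-into-hole hole = apply≈ tt hole (i-g↑ unit) ten-unit (oc-cong (≈sym ten-unit))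
oc∘-into-hole (parL C S) =
     apply tt hole (i-s (⟦ C ⟧ᶜ [ unit ]) oc∘ ⟦ S ⟧)
  ++ deriv-in-ctx (parL hole ⟦ S ⟧) (oc∘-into-hole C)
oc∘-into-hole (parR S C) =
     apply≈ tt hole (i-s (⟦ C ⟧ᶜ [ unit ]) oc∘ ⟦ S ⟧) (ten-cong par-comm ≈refl) par-comm
  ++ deriv-in-ctx (parR ⟦ S ⟧ hole) (oc∘-into-hole C)
oc∘-into-hole (tenL C S) =
  deriv-≈ˡ (≈trans ten-assoc (≈trans (ten-cong ≈refl ten-comm) (≈sym ten-assoc)))
           (deriv-in-ctx (tenL hole ⟦ S ⟧) (oc∘-into-hole C))
oc∘-into-hole (tenR S C) = deriv-≈ˡ ten-assoc (deriv-in-ctx (tenR ⟦ S ⟧ hole) (oc∘-into-hole C))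
oc∘-into-hole (seqL C S) =
     apply≈ tt hole (i-q↑ (⟦ C ⟧ᶜ [ unit ]) oc∘ ⟦ S ⟧ unit)
            (ten-cong ≈refl (≈sym seq-unitʳ)) (seq-cong ≈refl ten-unitʳ)
  ++ deriv-in-ctx (seqL hole ⟦ S ⟧) (oc∘-into-hole C)
oc∘-into-hole (seqR S C) =
     apply≈ tt hole (i-q↑ ⟦ S ⟧ unit (⟦ C ⟧ᶜ [ unit ]) oc∘)
            (ten-cong ≈refl (≈sym seq-unitˡ)) (seq-cong ten-unitʳ ≈refl)
  ++ deriv-in-ctx (seqR ⟦ S ⟧ hole) (oc∘-into-hole C)
oc∘-into-hole (wnC C) =
     apply tt (tenR (wn (par (⟦ C ⟧ᶜ [ unit ]) wn∘)) hole) (i-g↑ unit)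
  ++ apply tt hole (i-p↑ (par (⟦ C ⟧ᶜ [ unit ]) wn∘) oc∘)
  ++ apply tt (wnC hole) (i-s (⟦ C ⟧ᶜ [ unit ]) oc∘ wn∘)
  ++ deriv-in-ctx (wnC (parL hole wn∘)) (oc∘-into-hole C)
oc∘-into-hole (ocC C) =
     apply≈ tt (tenR (oc (ten (⟦ C ⟧ᶜ [ unit ]) oc∘)) hole) (i-w↑ unit) ≈refl ten-unitʳ
  ++ deriv-in-ctx (ocC (tenR (⟦ C ⟧ᶜ [ unit ]) hole)) (oc-emits-oc∘ unit)
  ++ deriv-≈ˡ (oc-cong (≈sym ten-assoc)) (deriv-in-ctx (ocC (tenL hole oc∘)) (oc∘-into-hole C))

wn∘-out-of-hole : ∀ C → Deriv SNEL-no-e (⟦ C ⟧ᶜ [ ⟦ wn∘ ⟧ ]) (par (⟦ C ⟧ᶜ [ unit ]) wn∘)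
wn∘-out-of-hole hole = apply≈ tt hole (i-g↓ unit) (wn-cong par-unit) (≈sym par-unit)
wn∘-out-of-hole (parL C S) =
  deriv-≈ʳ (deriv-in-ctx (parL hole ⟦ S ⟧) (wn∘-out-of-hole C))
           (≈trans par-assoc (≈trans (par-cong ≈refl par-comm) (≈sym par-assoc)))
wn∘-out-of-hole (parR S C) =
  deriv-≈ʳ (deriv-in-ctx (parR ⟦ S ⟧ hole) (wn∘-out-of-hole C)) (≈sym par-assoc)
wn∘-out-of-hole (tenL C S) =
     deriv-in-ctx (tenL hole ⟦ S ⟧) (wn∘-out-of-hole C)
  ++ apply tt hole (i-s (⟦ C ⟧ᶜ [ unit ]) ⟦ S ⟧ wn∘)
wn∘-out-of-hole (tenR S C) =
     deriv-in-ctx (tenR ⟦ S ⟧ hole) (wn∘-out-of-hole C)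
  ++ apply≈ tt hole (i-s (⟦ C ⟧ᶜ [ unit ]) ⟦ S ⟧ wn∘) ten-comm (par-cong ten-comm ≈refl)
wn∘-out-of-hole (seqL C S) =
     deriv-in-ctx (seqL hole ⟦ S ⟧) (wn∘-out-of-hole C)
  ++ apply≈ tt hole (i-q↓ (⟦ C ⟧ᶜ [ unit ]) ⟦ S ⟧ wn∘ unit)
            (seq-cong ≈refl (≈sym par-unitʳ)) (par-cong ≈refl seq-unitʳ)
wn∘-out-of-hole (seqR S C) =
     deriv-in-ctx (seqR ⟦ S ⟧ hole) (wn∘-out-of-hole C)
  ++ apply≈ tt hole (i-q↓ ⟦ S ⟧ (⟦ C ⟧ᶜ [ unit ]) unit wn∘)
            (seq-cong (≈sym par-unitʳ) ≈refl) (par-cong ≈refl seq-unitˡ)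
wn∘-out-of-hole (wnC C) =
     deriv-in-ctx (wnC (parL hole wn∘)) (wn∘-out-of-hole C)
  ++ deriv-≈ˡ (wn-cong par-assoc)
              (deriv-in-ctx (wnC (parR (⟦ C ⟧ᶜ [ unit ]) hole)) (wn-absorbs-wn∘ unit))
  ++ apply≈ tt (parR (wn (par (⟦ C ⟧ᶜ [ unit ]) wn∘)) hole) (i-w↓ unit)
            (≈sym par-unitʳ) ≈refl
wn∘-out-of-hole (ocC C) =
     deriv-in-ctx (ocC (tenL hole oc∘)) (wn∘-out-of-hole C)
  ++ apply tt (ocC hole) (i-s (⟦ C ⟧ᶜ [ unit ]) oc∘ wn∘)
  ++ apply tt hole (i-p↓ (ten (⟦ C ⟧ᶜ [ unit ]) oc∘) wn∘)
  ++ apply tt (parR (oc (ten (⟦ C ⟧ᶜ [ unit ]) oc∘)) hole) (i-g↓ unit)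

⟦⟧-inst : ∀ {ρ R T} → Inst ρ R T → SNEL-no-e ρ → Deriv SNEL-no-e ⟦ R ⟧ ⟦ T ⟧
⟦⟧-inst (i-ai↓ a b)    _ = apply tt hole (i-ai↓ a b)
⟦⟧-inst (i-ai↑ a b)    _ = apply tt hole (i-ai↑ a b)
⟦⟧-inst (i-s R T U)    _ = apply tt hole (i-s ⟦ R ⟧ ⟦ T ⟧ ⟦ U ⟧)
⟦⟧-inst (i-q↓ R T U V) _ = apply tt hole (i-q↓ ⟦ R ⟧ ⟦ T ⟧ ⟦ U ⟧ ⟦ V ⟧)
⟦⟧-inst (i-q↑ R T U V) _ = apply tt hole (i-q↑ ⟦ R ⟧ ⟦ T ⟧ ⟦ U ⟧ ⟦ V ⟧)
⟦⟧-inst (i-p↓ R T)     _ =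
     apply tt (ocC hole) (i-s ⟦ R ⟧ oc∘ ⟦ T ⟧)
  ++ apply tt hole (i-p↓ (ten ⟦ R ⟧ oc∘) ⟦ T ⟧)
  ++ apply≈ tt (parR (oc (ten ⟦ R ⟧ oc∘)) (wnC (parR ⟦ T ⟧ hole))) (i-w↓ unit)
            (par-cong ≈refl (wn-cong (≈sym par-unitʳ))) ≈refl
⟦⟧-inst (i-p↑ R T)     _ =
     apply tt hole (i-p↑ (par ⟦ R ⟧ wn∘) (ten ⟦ T ⟧ oc∘))
  ++ apply≈ tt (wnC (tenR (par ⟦ R ⟧ wn∘) (tenR ⟦ T ⟧ hole))) (i-w↑ unit)
            ≈refl (wn-cong (ten-cong ≈refl ten-unitʳ))
  ++ apply tt (wnC hole) (i-s ⟦ R ⟧ ⟦ T ⟧ wn∘)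
⟦⟧-inst i-e↓           ()
⟦⟧-inst i-e↑           ()
⟦⟧-inst (i-w↓ R)       _ = apply tt hole (i-w↓ (par ⟦ R ⟧ wn∘))
⟦⟧-inst (i-w↑ R)       _ = apply tt hole (i-w↑ (ten ⟦ R ⟧ oc∘))
⟦⟧-inst (i-b↓ R)       _ =
     apply≈ tt (parR (wn (par ⟦ R ⟧ wn∘)) (parR ⟦ R ⟧ hole)) (i-w↓ unit)
            (par-cong ≈refl (≈sym par-unitʳ)) ≈refl
  ++ apply tt hole (i-b↓ (par ⟦ R ⟧ wn∘))
⟦⟧-inst (i-b↑ R)       _ =
     apply tt hole (i-b↑ (ten ⟦ R ⟧ oc∘))
  ++ apply≈ tt (tenR (oc (ten ⟦ R ⟧ oc∘)) (tenR ⟦ R ⟧ hole)) (i-w↑ unit)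
            ≈refl (ten-cong ≈refl ten-unitʳ)
⟦⟧-inst (i-g↓ R)       _ =
     wn-deriv (wn-absorbs-wn∘ (par ⟦ R ⟧ wn∘))
  ++ apply tt hole (i-g↓ (par ⟦ R ⟧ wn∘))
⟦⟧-inst (i-g↑ R)       _ =
     apply tt hole (i-g↑ (ten ⟦ R ⟧ oc∘))
  ++ oc-deriv (oc-emits-oc∘ (ten ⟦ R ⟧ oc∘))

image : Str → Str
image S = par (ten ⟦ S ⟧ oc∘) wn∘

image-ctx : Ctx → Ctx
image-ctx C = parL (tenL ⟦ C ⟧ᶜ oc∘) wn∘

image-cong : ∀ {R T} → R ≈ T → image R ≈ image T
image-cong e = par-cong (ten-cong (enrich-cong oc∘ wn∘ true e) ≈refl) ≈refl

image-plug : ∀ C R → image (C [ R ]) ≈ image-ctx C [ ⟦ R ⟧ ]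
image-plug C R = ≡⇒≈ (cong (λ z → par (ten z oc∘) wn∘) (⟦⟧-plug C R))

image-inst : ∀ C {ρ R T} → Inst ρ R T →
             Deriv SNEL-no-e (image-ctx C [ ⟦ R ⟧ ]) (image-ctx C [ ⟦ T ⟧ ])
image-inst C i-e↓ =
     deriv-in-ctx (parL (tenR (⟦ C ⟧ᶜ [ unit ]) hole) wn∘) (oc-emits-oc∘ unit)
  ++ deriv-≈ˡ (par-cong (≈sym ten-assoc) ≈refl)
              (deriv-in-ctx (parL (tenL hole oc∘) wn∘) (oc∘-into-hole C))
image-inst C i-e↑ =
     deriv-in-ctx (parL (tenL hole oc∘) wn∘) (wn∘-out-of-hole C)
  ++ apply tt (parL hole wn∘) (i-s (⟦ C ⟧ᶜ [ unit ]) oc∘ wn∘)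
  ++ deriv-≈ˡ par-assoc
              (deriv-in-ctx (parR (ten (⟦ C ⟧ᶜ [ unit ]) oc∘) hole) (wn-absorbs-wn∘ unit))
image-inst C i@(i-ai↓ _ _)    = deriv-in-ctx (image-ctx C) (⟦⟧-inst i tt)
image-inst C i@(i-ai↑ _ _)    = deriv-in-ctx (image-ctx C) (⟦⟧-inst i tt)
image-inst C i@(i-s _ _ _)    = deriv-in-ctx (image-ctx C) (⟦⟧-inst i tt)
image-inst C i@(i-q↓ _ _ _ _) = deriv-in-ctx (image-ctx C) (⟦⟧-inst i tt)
image-inst C i@(i-q↑ _ _ _ _) = deriv-in-ctx (image-ctx C) (⟦⟧-inst i tt)
image-inst C i@(i-p↓ _ _)     = deriv-in-ctx (image-ctx C) (⟦⟧-inst i tt)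
image-inst C i@(i-p↑ _ _)     = deriv-in-ctx (image-ctx C) (⟦⟧-inst i tt)
image-inst C i@(i-w↓ _)       = deriv-in-ctx (image-ctx C) (⟦⟧-inst i tt)
image-inst C i@(i-w↑ _)       = deriv-in-ctx (image-ctx C) (⟦⟧-inst i tt)
image-inst C i@(i-b↓ _)       = deriv-in-ctx (image-ctx C) (⟦⟧-inst i tt)
image-inst C i@(i-b↑ _)       = deriv-in-ctx (image-ctx C) (⟦⟧-inst i tt)
image-inst C i@(i-g↓ _)       = deriv-in-ctx (image-ctx C) (⟦⟧-inst i tt)
image-inst C i@(i-g↑ _)       = deriv-in-ctx (image-ctx C) (⟦⟧-inst i tt)

image-deriv : ∀ {T R} → Deriv SNEL T R → Deriv SNEL-no-e (image T) (image R)
image-deriv (done e) = done (image-cong e)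
image-deriv (step ρ x C r c i pe ce ∷ d) =
     deriv-≈ˡ (≈trans (image-cong pe) (image-plug C r)) (image-inst C i)
  ++ deriv-≈ˡ (≈sym (≈trans (image-cong ce) (image-plug C c))) (image-deriv d)

create-oc∘ : ∀ S → Deriv only-e↓ S (ten (enrich oc∘ unit true S) oc∘)
create-oc∘ S =
     deriv-≈ˡ (≈-enrich-unit S) (enrich-mono (apply tt hole i-e↓) (done ≈refl) true S)
  ++ apply≈ tt (tenR (enrich oc∘ unit true S) hole) i-e↓ (≈sym ten-unitʳ) ≈refl

enter-image : ∀ S → Deriv SNEL-no-e (ten (enrich oc∘ unit true S) oc∘) (image S)
enter-image S =
     ten-deriv (enrich-mono (done ≈refl) (apply tt hole (i-w↓ unit)) true S) (done ≈refl)
  ++ apply≈ tt (parR (ten ⟦ S ⟧ oc∘) hole) (i-w↓ unit) (≈sym par-unitʳ) ≈refl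

leave-image : ∀ S → Deriv SNEL-no-e (image S) (par (enrich unit wn∘ true S) wn∘)
leave-image S =
  deriv-≈ʳ (par-deriv (ten-deriv (enrich-mono (apply tt hole (i-w↑ unit)) (done ≈refl) true S)
                                 (apply tt hole (i-w↑ unit)))
                      (done ≈refl))
           (par-cong ten-unitʳ ≈refl)

destroy-wn∘ : ∀ S → Deriv only-e↑ (par (enrich unit wn∘ true S) wn∘) S
destroy-wn∘ S =
     apply≈ tt (parR (enrich unit wn∘ true S) hole) i-e↑ ≈refl par-unitʳ
  ++ deriv-≈ʳ (enrich-mono (done ≈refl) (apply tt hole i-e↑) true S) (≈sym (≈-enrich-unit S))

lemma4p5 : ∀ (T R : Str) → Deriv SNEL T R →
    Σ Str (λ W₁ → Σ Str (λ Z₁ →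
      Deriv only-e↓ T W₁ × Deriv SNEL-no-e W₁ Z₁ × Deriv only-e↑ Z₁ R))
lemma4p5 T R d =
  _ , _ , create-oc∘ T , enter-image T ++ image-deriv d ++ leave-image R , destroy-wn∘ R
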